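{- Let $A=[A_1,\dots,A_n]$ be an $n\times n\times n$ near-permutation alternating sign hypermatrix with $n>3$. Then $L(A)=1A_1+2A_2+\cdots+nA_n$ has no constant line (no row or column all of whose entries are equal).
   Context: An $n\times n$ alternating sign matrix (ASM) is a $(0,\pm1)$-matrix whose rows and columns each have nonzeros alternating in sign beginning and ending with $+1$. For an $n\times n\times n$ hypermatrix $A=[a_{ijk}]$, the horizontal planes are $A_k=[a_{ijk}]_{i,j}$, written $A=[A_1,\dots,A_n]$, and lines are obtained by fixing two indices and varying the third. $A$ is an alternating sign hypermatrix (ASHM) if every line has nonzeros alternating in sign beginning and ending with $+1$. A near-permutation hypermatrix is an ASHM in which every line contains at most one $-1$. -}

module Defs where

open import Data.Nat using (ℕ; suc; _≤_)
open import Data.Integer using (ℤ; +_; -[1+_]; _+_; _*_)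
open import Data.Fin using (Fin; toℕ)
open import Data.List using (List; []; _∷_; filter; length)
open import Data.Vec.Functional using (Vector; toList)
open import Data.Product using (_×_)
open import Relation.Nullary using (¬_)
open import Relation.Binary.PropositionalEquality using (_≡_)
import Data.Integer.Properties as ℤP
open import Relation.Nullary.Decidable using (¬?)

Σℤ : ∀ {n} → (Fin n → ℤ) → ℤ
Σℤ = Data.Vec.Functional.foldr _+_ (+ 0)

data Sign : ℤ → Set where
  zer : Sign (+ 0)
  pos : Sign (+ 1)
  neg : Sign -[1+ 0 ]

data AltNZ : List ℤ → Set where
  one  : AltNZ (+ 1 ∷ [])
  step : ∀ {xs} → AltNZ xs → AltNZ (+ 1 ∷ -[1+ 0 ] ∷ xs)

nonzeros : List ℤ → List ℤ
nonzeros = filter (λ x → ¬? (x ℤP.≟ + 0))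

negOnes : List ℤ → List ℤ
negOnes = filter (λ x → x ℤP.≟ -[1+ 0 ])

AltLine : ∀ {n} → Vector ℤ n → Set
AltLine {n} v = (∀ i → Sign (v i)) × AltNZ (nonzeros (toList v))

Hyper : ℕ → Set
Hyper n = Fin n → Fin n → Fin n → ℤ

ForAllLines : ∀ {n} → (Vector ℤ n → Set) → Hyper n → Set
ForAllLines P A =
  (∀ i j → P (λ k → A i j k)) ×
  (∀ i k → P (λ j → A i j k)) ×
  (∀ j k → P (λ i → A i j k))

IsASHM : ∀ {n} → Hyper n → Set
IsASHM A = ForAllLines AltLine A

AtMostOneNeg : ∀ {n} → Vector ℤ n → Set
AtMostOneNeg v = length (negOnes (toList v)) ≤ 1

IsNearPermutation : ∀ {n} → Hyper n → Set
IsNearPermutation A = IsASHM A × ForAllLines AtMostOneNeg A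

-- L(A) = 1 A_1 + 2 A_2 + ... + n A_n  (A_k = horizontal plane, index k)
L : ∀ {n} → Hyper n → Fin n → Fin n → ℤ
L A i j = Σℤ (λ k → + suc (toℕ k) * A i j k)

Constant : ∀ {n} → Vector ℤ n → Set
Constant v = ∀ a b → v a ≡ v b

NoConstantLine : ∀ {n} → (Fin n → Fin n → ℤ) → Set
NoConstantLine M = (∀ i → ¬ Constant (λ j → M i j)) × (∀ j → ¬ Constant (λ i → M i j))

module Submission where

-- A row (resp. column) of L(A) is the vector j ↦ Σₖ (k+1)·M j k of weighted
-- row sums of a vertical slab M = A restricted to a fixed i (resp. j); such
-- a slab is an alternating sign matrix whose columns contain at most one -1.
-- In an ASM M the top row lies in {0,1} entrywise, so (being alternating) it
-- is a unit vector e_c, and its weighted sum is the weight of c.  If the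
-- second row has the same weighted sum, it cannot also be a 0/1 unit vector
-- (the weights are distinct and M 1 c ≠ 1), which forces M 1 c = -1.  Reading
-- the slab upside down (alternation is invariant under reversal) gives
-- M (n-2) c = -1 for the same c when the last two rows agree too.  For n > 3
-- the rows 1 and n-2 differ, so column c would contain two -1's.

open import Defs
open import Data.Nat using (ℕ; zero; suc; _<_; _≤_; s≤s; z≤n)
import Data.Nat.Properties as ℕP
open import Data.Integer using (ℤ; +_; -[1+_]; _+_; _*_)
import Data.Integer.Properties as ℤP
open import Data.Fin using (Fin; zero; suc; toℕ; opposite; fromℕ; inject₁)
import Data.Fin.Properties as FinP
open import Data.List using (List; []; _∷_; _++_; _∷ʳ_; reverse; length; filter)
import Data.List.Properties as ListP
open import Data.Vec.Functional using (Vector; toList)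
open import Data.Product using (_×_; _,_; proj₁; proj₂; Σ-syntax)
open import Data.Sum using (_⊎_; inj₁; inj₂; map₂)
open import Data.Bool using (true; false)
open import Data.Empty using (⊥-elim)
open import Function.Definitions using (Injective)
open import Relation.Nullary using (¬_; yes; no; does)
open import Relation.Unary using (Pred; Decidable)
open import Relation.Binary.PropositionalEquality
open ≡-Reasoning

altNZ-snoc : ∀ {xs} → AltNZ xs → AltNZ (xs ++ -[1+ 0 ] ∷ + 1 ∷ [])
altNZ-snoc one      = step one
altNZ-snoc (step p) = step (altNZ-snoc p)

altNZ-reverse : ∀ {xs} → AltNZ xs → AltNZ (reverse xs)
altNZ-reverse one = one
altNZ-reverse (step {xs} p) =
  subst AltNZ (sym (ListP.reverse-++ (+ 1 ∷ -[1+ 0 ] ∷ []) xs))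
    (altNZ-snoc (altNZ-reverse p))

filter-reverse : ∀ {a p} {A : Set a} {P : Pred A p} (P? : Decidable P) (xs : List A) →
  filter P? (reverse xs) ≡ reverse (filter P? xs)
filter-reverse P? [] = refl
filter-reverse P? (x ∷ xs) = begin
  filter P? (reverse (x ∷ xs))              ≡⟨ cong (filter P?) (ListP.unfold-reverse x xs) ⟩
  filter P? (reverse xs ++ [x])             ≡⟨ ListP.filter-++ P? (reverse xs) [x] ⟩
  filter P? (reverse xs) ++ filter P? [x]   ≡⟨ cong₂ _++_ (filter-reverse P? xs) singleton ⟩
  reverse (filter P? xs) ++ reverse (filter P? [x])
                                            ≡⟨ ListP.reverse-++ (filter P? [x]) (filter P? xs) ⟨
  reverse (filter P? [x] ++ filter P? xs)   ≡⟨ cong reverse (ListP.filter-++ P? [x] xs) ⟨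
  reverse (filter P? (x ∷ xs))              ∎
  where
  [x] = x ∷ []
  -- a list of length at most one is its own reverse
  singleton : filter P? [x] ≡ reverse (filter P? [x])
  singleton with does (P? x)
  ... | true  = refl
  ... | false = refl

toList-snoc : ∀ {a} {A : Set a} {n} (u : Vector A (suc n)) →
  toList u ≡ toList (λ k → u (inject₁ k)) ∷ʳ u (fromℕ n)
toList-snoc {n = zero}  u = refl
toList-snoc {n = suc n} u = cong (u zero ∷_) (toList-snoc (λ k → u (suc k)))

toList-opposite : ∀ {a} {A : Set a} {n} (u : Vector A n) →
  toList (λ k → u (opposite k)) ≡ reverse (toList u)
toList-opposite {n = zero}  u = refl
toList-opposite {n = suc n} u = begin
  u (fromℕ n) ∷ toList (λ k → u (inject₁ (opposite k)))
    ≡⟨ cong (u (fromℕ n) ∷_) (toList-opposite (λ k → u (inject₁ k))) ⟩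
  u (fromℕ n) ∷ reverse (toList (λ k → u (inject₁ k)))
    ≡⟨ ListP.reverse-++ (toList (λ k → u (inject₁ k))) (u (fromℕ n) ∷ []) ⟨
  reverse (toList (λ k → u (inject₁ k)) ∷ʳ u (fromℕ n))
    ≡⟨ cong reverse (toList-snoc u) ⟨
  reverse (toList u) ∎

altLine-opposite : ∀ {n} (u : Vector ℤ n) → AltLine u → AltLine (λ k → u (opposite k))
altLine-opposite u (signs , alt) =
  (λ k → signs (opposite k)) ,
  subst AltNZ (sym nonzeros-opposite) (altNZ-reverse alt)
  where
  nonzeros-opposite : nonzeros (toList (λ k → u (opposite k))) ≡ reverse (nonzeros (toList u))
  nonzeros-opposite = trans (cong nonzeros (toList-opposite u)) (filter-reverse _ (toList u))

-- Values in {0, 1}: the possible entries of a line before its first -1.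
Bin : ℤ → Set
Bin x = x ≡ + 0 ⊎ x ≡ + 1

-- The first nonzero entry of an alternating line is +1, and the next
-- nonzero entry after it is -1.  Restricted to the first two entries:
data LeadingPair : ℤ → ℤ → Set where
  zero-first : ∀ {y} → Bin y → LeadingPair (+ 0) y
  one-first  : ∀ {y} → y ≡ + 0 ⊎ y ≡ -[1+ 0 ] → LeadingPair (+ 1) y

leadingPair : ∀ {x y xs} → Sign x → Sign y → AltNZ (nonzeros (x ∷ y ∷ xs)) → LeadingPair x y
leadingPair zer zer _ = zero-first (inj₁ refl)
leadingPair zer pos _ = zero-first (inj₂ refl)
leadingPair zer neg ()
leadingPair pos zer _ = one-first (inj₁ refl)
leadingPair pos pos ()
leadingPair pos neg _ = one-first (inj₂ refl)
leadingPair neg _   ()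

leading : ∀ {m} (u : Vector ℤ (suc (suc m))) → AltLine u → LeadingPair (u zero) (u (suc zero))
leading u (signs , alt) = leadingPair (signs zero) (signs (suc zero)) alt

leading-binary : ∀ {x y} → LeadingPair x y → Bin x
leading-binary (zero-first _) = inj₁ refl
leading-binary (one-first _)  = inj₂ refl

after-zero : ∀ {x y} → LeadingPair x y → x ≡ + 0 → Bin y
after-zero (zero-first b) _ = b

after-one : ∀ {x y} → LeadingPair x y → x ≡ + 1 → y ≡ + 0 ⊎ y ≡ -[1+ 0 ]
after-one (one-first b) _ = b

IsUnitAt : ∀ {n} → Vector ℤ n → Fin n → Set
IsUnitAt w c = w c ≡ + 1 × (∀ k → w k ≡ + 0 ⊎ k ≡ c)

weightedSum : ∀ {n} → (Fin n → ℤ) → Vector ℤ n → ℤ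
weightedSum g w = Σℤ (λ k → g k * w k)

weightedSum-zero : ∀ {n} (g : Fin n → ℤ) {w : Vector ℤ n} → (∀ k → w k ≡ + 0) →
  weightedSum g w ≡ + 0
weightedSum-zero {zero}  g z = refl
weightedSum-zero {suc n} g {w} z = begin
  g zero * w zero + weightedSum (λ k → g (suc k)) (λ k → w (suc k))
    ≡⟨ cong₂ (λ a b → g zero * a + b) (z zero) (weightedSum-zero (λ k → g (suc k)) (λ k → z (suc k))) ⟩
  g zero * + 0 + + 0
    ≡⟨ cong (_+ + 0) (ℤP.*-zeroʳ (g zero)) ⟩
  + 0 ∎

weightedSum-unit : ∀ {n} (g : Fin n → ℤ) {w : Vector ℤ n} {c : Fin n} → IsUnitAt w c →
  weightedSum g w ≡ g c
weightedSum-unit {suc n} g {w} {zero} (is-one , support) = begin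
  g zero * w zero + weightedSum (λ k → g (suc k)) (λ k → w (suc k))
    ≡⟨ cong₂ (λ a b → g zero * a + b) is-one (weightedSum-zero (λ k → g (suc k)) tail-zero) ⟩
  g zero * + 1 + + 0
    ≡⟨ trans (ℤP.+-identityʳ _) (ℤP.*-identityʳ (g zero)) ⟩
  g zero ∎
  where
  tail-zero : ∀ k → w (suc k) ≡ + 0
  tail-zero k with support (suc k)
  ... | inj₁ z = z
weightedSum-unit {suc n} g {w} {suc c} (is-one , support) = begin
  g zero * w zero + weightedSum (λ k → g (suc k)) (λ k → w (suc k))
    ≡⟨ cong₂ (λ a b → g zero * a + b) head-zero
         (weightedSum-unit (λ k → g (suc k)) (is-one , λ k → map₂ FinP.suc-injective (support (suc k)))) ⟩
  g zero * + 0 + g (suc c)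
    ≡⟨ trans (cong (_+ g (suc c)) (ℤP.*-zeroʳ (g zero))) (ℤP.+-identityˡ (g (suc c))) ⟩
  g (suc c) ∎
  where
  head-zero : w zero ≡ + 0
  head-zero with support zero
  ... | inj₁ z = z

head-subst : ∀ {n} (P : List ℤ → Set) (w : Vector ℤ (suc n)) {x : ℤ} → w zero ≡ x →
  P (toList w) → P (x ∷ toList (λ k → w (suc k)))
head-subst P w refl p = p

one-one-not-alternating : ∀ {xs} → ¬ AltNZ (+ 1 ∷ + 1 ∷ xs)
one-one-not-alternating ()

-- After a +1, an alternating list has no further +1, so a 0/1 vector
-- following a +1 must vanish.
binary-after-one : ∀ {n} (w : Vector ℤ n) → (∀ k → Bin (w k)) →
  AltNZ (+ 1 ∷ nonzeros (toList w)) → ∀ k → w k ≡ + 0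
binary-after-one {suc n} w binary alt with binary zero
... | inj₂ is-one = ⊥-elim (one-one-not-alternating (head-subst (λ xs → AltNZ (+ 1 ∷ nonzeros xs)) w is-one alt))
... | inj₁ z = λ { zero → z ; (suc k) → tail-zero k }
  where
  tail-zero : ∀ k → w (suc k) ≡ + 0
  tail-zero = binary-after-one (λ k → w (suc k)) (λ k → binary (suc k))
                (head-subst (λ xs → AltNZ (+ 1 ∷ nonzeros xs)) w z alt)

binary-unit : ∀ {n} (w : Vector ℤ n) → (∀ k → Bin (w k)) → AltNZ (nonzeros (toList w)) →
  Σ[ c ∈ Fin n ] IsUnitAt w c
binary-unit {suc n} w binary alt with binary zero
... | inj₂ is-one = zero , is-one , support
  where
  support : ∀ k → w k ≡ + 0 ⊎ k ≡ zero
  support zero    = inj₂ refl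
  support (suc k) = inj₁ (binary-after-one (λ k → w (suc k)) (λ k → binary (suc k))
                            (head-subst (λ xs → AltNZ (nonzeros xs)) w is-one alt) k)
... | inj₁ z with binary-unit (λ k → w (suc k)) (λ k → binary (suc k))
                    (head-subst (λ xs → AltNZ (nonzeros xs)) w z alt)
...   | c , is-one , tail-support = suc c , is-one , support
  where
  support : ∀ k → w k ≡ + 0 ⊎ k ≡ suc c
  support zero    = inj₁ z
  support (suc k) = map₂ (cong suc) (tail-support k)

negOnes-cons : ∀ x xs → length (negOnes xs) ≤ length (negOnes (x ∷ xs))
negOnes-cons x xs with x ℤP.≟ -[1+ 0 ]
... | yes _ = ℕP.n≤1+n _
... | no _  = ℕP.≤-refl

negOnes-head : ∀ {x} xs → x ≡ -[1+ 0 ] → length (negOnes (x ∷ xs)) ≡ suc (length (negOnes xs))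
negOnes-head xs is-neg = cong length (ListP.filter-accept (λ x → x ℤP.≟ -[1+ 0 ]) is-neg)

one-negOne : ∀ {n} (u : Vector ℤ n) a → u a ≡ -[1+ 0 ] → 1 ≤ length (negOnes (toList u))
one-negOne u zero    is-neg = subst (1 ≤_) (sym (negOnes-head (toList (λ k → u (suc k))) is-neg)) (s≤s z≤n)
one-negOne u (suc a) is-neg = ℕP.≤-trans (one-negOne (λ k → u (suc k)) a is-neg) (negOnes-cons (u zero) _)

two-negOnes : ∀ {n} (u : Vector ℤ n) {a b} → ¬ a ≡ b →
  u a ≡ -[1+ 0 ] → u b ≡ -[1+ 0 ] → 2 ≤ length (negOnes (toList u))
two-negOnes u {zero}  {zero}  a≢b _ _ = ⊥-elim (a≢b refl)
two-negOnes u {zero}  {suc b} _ neg-a neg-b =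
  subst (2 ≤_) (sym (negOnes-head _ neg-a)) (s≤s (one-negOne (λ k → u (suc k)) b neg-b))
two-negOnes u {suc a} {zero}  _ neg-a neg-b =
  subst (2 ≤_) (sym (negOnes-head _ neg-b)) (s≤s (one-negOne (λ k → u (suc k)) a neg-a))
two-negOnes u {suc a} {suc b} a≢b neg-a neg-b =
  ℕP.≤-trans (two-negOnes (λ k → u (suc k)) (λ a≡b → a≢b (cong suc a≡b)) neg-a neg-b)
             (negOnes-cons (u zero) _)

IsASM : ∀ {n} → (Fin n → Fin n → ℤ) → Set
IsASM M = (∀ j → AltLine (λ k → M j k)) × (∀ k → AltLine (λ j → M j k))

asm-upside-down : ∀ {n} {M : Fin n → Fin n → ℤ} → IsASM M → IsASM (λ j k → M (opposite j) k)
asm-upside-down {M = M} (rows , cols) =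
  (λ j → rows (opposite j)) , (λ k → altLine-opposite (λ j → M j k) (cols k))

top-rows : ∀ {m} {g : Fin (suc (suc m)) → ℤ} → Injective _≡_ _≡_ g →
  (M : Fin (suc (suc m)) → Fin (suc (suc m)) → ℤ) → IsASM M →
  weightedSum g (M zero) ≡ weightedSum g (M (suc zero)) →
  Σ[ c ∈ Fin (suc (suc m)) ] weightedSum g (M zero) ≡ g c × M (suc zero) c ≡ -[1+ 0 ]
top-rows {g = g} g-inj M (rows , cols) same = c , first-sum , below-c
  where
  lead : ∀ k → LeadingPair (M zero k) (M (suc zero) k)
  lead k = leading (λ j → M j k) (cols k)
  first-unit : Σ[ c ∈ _ ] IsUnitAt (M zero) c
  first-unit = binary-unit (M zero) (λ k → leading-binary (lead k)) (proj₂ (rows zero))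
  c = proj₁ first-unit
  first-sum : weightedSum g (M zero) ≡ g c
  first-sum = weightedSum-unit g (proj₂ first-unit)
  -- If M 1 c were 0, the second row would be 0/1 as well, hence a unit
  -- vector e_d; equal sums force d = c, contradicting M 1 c = 0.
  not-zero-below : ¬ M (suc zero) c ≡ + 0
  not-zero-below zero-below = zero≢one (trans (sym zero-below) one-at-c)
    where
    second-binary : ∀ k → Bin (M (suc zero) k)
    second-binary k with proj₂ (proj₂ first-unit) k
    ... | inj₁ above-zero = after-zero (lead k) above-zero
    ... | inj₂ refl       = inj₁ zero-below
    second-unit : Σ[ d ∈ _ ] IsUnitAt (M (suc zero)) d
    second-unit = binary-unit (M (suc zero)) second-binary (proj₂ (rows (suc zero)))
    c≡d : c ≡ proj₁ second-unit
    c≡d = g-inj (trans (sym first-sum) (trans same (weightedSum-unit g (proj₂ second-unit))))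
    one-at-c : M (suc zero) c ≡ + 1
    one-at-c = subst (λ k → M (suc zero) k ≡ + 1) (sym c≡d) (proj₁ (proj₂ second-unit))
    zero≢one : ¬ (+ 0 ≡ + 1)
    zero≢one ()
  below-c : M (suc zero) c ≡ -[1+ 0 ]
  below-c with after-one (lead c) (proj₁ (proj₂ first-unit))
  ... | inj₁ zero-below = ⊥-elim (not-zero-below zero-below)
  ... | inj₂ neg-below  = neg-below

-- For n > 3 and distinct weights, the weighted row sums of an ASM whose
-- columns have at most one -1 are not all equal: the top two rows and the
-- bottom two rows would put -1's in rows 1 and n-2 of the same column.
weighted-rows-not-constant : ∀ {m} {g : Fin (suc (suc (suc (suc m)))) → ℤ} → Injective _≡_ _≡_ g →
  (M : Fin (suc (suc (suc (suc m)))) → Fin (suc (suc (suc (suc m)))) → ℤ) → IsASM M →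
  (∀ k → AtMostOneNeg (λ j → M j k)) → ¬ Constant (λ j → weightedSum g (M j))
weighted-rows-not-constant {g = g} g-inj M asm at-most-one constant =
  ℕP.<-irrefl refl (ℕP.≤-trans (two-negOnes (λ j → M j c) row1≢row[n-2] neg-top neg-bottom) (at-most-one c))
  where
  top    = top-rows g-inj M asm (constant zero (suc zero))
  bottom = top-rows g-inj (λ j k → M (opposite j) k) (asm-upside-down asm)
             (constant (opposite zero) (opposite (suc zero)))
  c = proj₁ top
  -- both rows 0 and n-1 have weighted sum g c and g c', so c = c'
  same-column : c ≡ proj₁ bottom
  same-column = g-inj (trans (sym (proj₁ (proj₂ top)))
                        (trans (constant zero (opposite zero)) (proj₁ (proj₂ bottom))))
  neg-top : M (suc zero) c ≡ -[1+ 0 ]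
  neg-top = proj₂ (proj₂ top)
  neg-bottom : M (opposite (suc zero)) c ≡ -[1+ 0 ]
  neg-bottom = subst (λ k → M (opposite (suc zero)) k ≡ -[1+ 0 ]) (sym same-column) (proj₂ (proj₂ bottom))
  row1≢row[n-2] : ¬ suc zero ≡ opposite (suc zero)
  row1≢row[n-2] ()

position-weight : ∀ {n} → Fin n → ℤ
position-weight k = + suc (toℕ k)

position-weight-injective : ∀ {n} → Injective _≡_ _≡_ (position-weight {n})
position-weight-injective eq = FinP.toℕ-injective (ℕP.suc-injective (ℤP.+-injective eq))

-- Rows of L(A) are weighted row sums of the slabs with fixed i, columns of
-- L(A) those of the slabs with fixed j.
theorem3p4 : (n : ℕ) → 3 < n → (A : Hyper n) → IsNearPermutation A →
    NoConstantLine (L A)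
theorem3p4 (suc (suc (suc (suc m)))) (s≤s (s≤s (s≤s (s≤s _))))
           A ((lines-k , lines-j , lines-i) , (_ , neg-j , neg-i)) =
  (λ i → weighted-rows-not-constant position-weight-injective (λ j k → A i j k)
           ((λ j → lines-k i j) , (λ k → lines-j i k)) (λ k → neg-j i k)) ,
  (λ j → weighted-rows-not-constant position-weight-injective (λ i k → A i j k)
           ((λ i → lines-k i j) , (λ k → lines-i j k)) (λ k → neg-i j k))
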